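{- Let $P$ be a (multiplicative) probability over DmBL or over DmBL$_\ast$, and write $P(\psi|\phi)$ for $P\bigl((\psi|\phi)\bigr)$. Then for all $\phi,\psi\in\mathcal{L}$: $P(\psi|\phi)\,P(\phi)=P(\phi\wedge\psi)$.
   Context: Fix a set $\Theta$ of atomic propositions. The language $\mathcal{L}$ is the smallest set containing $\Theta$ and closed under $\neg\phi$, $\Box\phi$, $\phi\rightarrow\psi$ and the conditional $(\psi|\phi)$. Abbreviations: $\phi\vee\psi=\neg\phi\rightarrow\psi$, $\phi\wedge\psi=\neg(\neg\phi\vee\neg\psi)$, $\phi\leftrightarrow\psi=(\phi\rightarrow\psi)\wedge(\psi\rightarrow\phi)$, $\top=\theta_0\rightarrow\theta_0$ for a fixed $\theta_0\in\Theta$, $\bot=\neg\top$, $\psi\times\phi=\Box\bigl((\psi|\phi)\leftrightarrow\psi\bigr)$. The theorems ($\vdash$) of DmBL are the smallest set containing all instances of the schemes c1 $\phi\rightarrow(\psi\rightarrow\phi)$, c2 $(\eta\rightarrow(\phi\rightarrow\psi))\rightarrow((\eta\rightarrow\phi)\rightarrow(\eta\rightarrow\psi))$, c3 $(\neg\phi\rightarrow\neg\psi)\rightarrow((\neg\phi\rightarrow\psi)\rightarrow\phi)$, m2 $\Box(\phi\rightarrow\psi)\rightarrow(\Box\phi\rightarrow\Box\psi)$, m3 $\Box\phi\rightarrow\phi$, b1 $\Box(\phi\rightarrow\psi)\rightarrow(\Box\neg\phi\vee\Box(\psi|\phi))$, b2 $((\psi\rightarrow\eta)|\phi)\rightarrow((\psi|\phi)\rightarrow(\eta|\phi))$,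 b3 $(\psi|\phi)\rightarrow(\phi\rightarrow\psi)$, b4 $\neg(\neg\psi|\phi)\leftrightarrow(\psi|\phi)$, b5 $(\psi\times\phi)\leftrightarrow(\phi\times\psi)$, closed under modus ponens and necessitation (from $\vdash\phi$ infer $\vdash\Box\phi$). DmBL$_\ast$ is the same with b5 replaced by b5.weak.A $(\psi\times\neg\phi)\leftrightarrow(\psi\times\phi)$ and b5.weak.B $\Box(\psi\leftrightarrow\eta)\rightarrow\Box((\phi|\psi)\leftrightarrow(\phi|\eta))$. $\phi\equiv\psi$ means $\vdash\phi\leftrightarrow\psi$ in the logic considered. A (multiplicative) probability over the logic is a function $P:\mathcal{L}\to\mathbb{R}^+$ with: $\phi\equiv\psi\Rightarrow P(\phi)=P(\psi)$; $P(\phi\wedge\psi)+P(\phi\vee\psi)=P(\phi)+P(\psi)$; $P(\bot)=0$; $P(\top)=1$; and $\vdash\phi\times\psi$ implies $P(\phi\wedge\psi)=P(\phi)P(\psi)$. -}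

module Defs where

open import Level using (Level; _⊔_; suc)
open import Algebra.Bundles using (CommutativeRing)

data Fm (A : Set) : Set where
  atom : A → Fm A
  ¬'_  : Fm A → Fm A
  □_   : Fm A → Fm A
  _⇒_  : Fm A → Fm A → Fm A
  -- cond ψ φ  is the conditional (ψ | φ)
  cond : Fm A → Fm A → Fm A

infix  9 ¬'_ □_
infixr 5 _⇒_

module _ {A : Set} where
  infixr 6 _∧_
  infixr 5 _∨_
  infix  4 _⇔_ _⊠_

  _∨_ : Fm A → Fm A → Fm A
  φ ∨ ψ = (¬' φ) ⇒ ψ

  _∧_ : Fm A → Fm A → Fm A
  φ ∧ ψ = ¬' ((¬' φ) ∨ (¬' ψ))

  _⇔_ : Fm A → Fm A → Fm A
  φ ⇔ ψ = (φ ⇒ ψ) ∧ (ψ ⇒ φ)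

  _⊠_ : Fm A → Fm A → Fm A
  ψ ⊠ φ = □ (cond ψ φ ⇔ ψ)

  ⊤' : A → Fm A
  ⊤' θ₀ = atom θ₀ ⇒ atom θ₀

  ⊥' : A → Fm A
  ⊥' θ₀ = ¬' (⊤' θ₀)

data Logic : Set where
  DmBL  : Logic
  DmBL* : Logic

data ⊢ {A : Set} : Logic → Fm A → Set where
  c1 : ∀ {L} φ ψ → ⊢ L (φ ⇒ (ψ ⇒ φ))
  c2 : ∀ {L} η φ ψ → ⊢ L ((η ⇒ (φ ⇒ ψ)) ⇒ ((η ⇒ φ) ⇒ (η ⇒ ψ)))
  c3 : ∀ {L} φ ψ → ⊢ L (((¬' φ) ⇒ (¬' ψ)) ⇒ (((¬' φ) ⇒ ψ) ⇒ φ))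
  m2 : ∀ {L} φ ψ → ⊢ L (□ (φ ⇒ ψ) ⇒ (□ φ ⇒ □ ψ))
  m3 : ∀ {L} φ → ⊢ L (□ φ ⇒ φ)
  b1 : ∀ {L} φ ψ → ⊢ L (□ (φ ⇒ ψ) ⇒ ((□ (¬' φ)) ∨ (□ (cond ψ φ))))
  b2 : ∀ {L} φ ψ η → ⊢ L (cond (ψ ⇒ η) φ ⇒ (cond ψ φ ⇒ cond η φ))
  b3 : ∀ {L} φ ψ → ⊢ L (cond ψ φ ⇒ (φ ⇒ ψ))
  b4 : ∀ {L} φ ψ → ⊢ L ((¬' (cond (¬' ψ) φ)) ⇔ cond ψ φ)
  b5 : ∀ φ ψ → ⊢ DmBL ((ψ ⊠ φ) ⇔ (φ ⊠ ψ))
  b5-weak-A : ∀ φ ψ → ⊢ DmBL* ((ψ ⊠ (¬' φ)) ⇔ (ψ ⊠ φ))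
  b5-weak-B : ∀ φ ψ η → ⊢ DmBL* (□ (ψ ⇔ η) ⇒ □ (cond φ ψ ⇔ cond φ η))
  mp  : ∀ {L φ ψ} → ⊢ L (φ ⇒ ψ) → ⊢ L φ → ⊢ L ψ
  nec : ∀ {L φ} → ⊢ L φ → ⊢ L (□ φ)

-- A multiplicative probability over logic L, with values in a commutative
-- ring R (standing in for ℝ) equipped with an order relation _≤_ used to
-- express nonnegativity of values.
record IsProbability {c ℓ ℓ' : Level} {A : Set} (θ₀ : A) (L : Logic)
       (R : CommutativeRing c ℓ) (_≤_ : CommutativeRing.Carrier R → CommutativeRing.Carrier R → Set ℓ')
       (P : Fm A → CommutativeRing.Carrier R) : Set (c ⊔ ℓ ⊔ ℓ') where
  open CommutativeRing R renaming (_≈_ to _≈R_; _+_ to _+R_; _*_ to _*R_)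
  field
    nonneg : ∀ φ → 0# ≤ P φ
    respect : ∀ φ ψ → ⊢ L (φ ⇔ ψ) → P φ ≈R P ψ
    additive : ∀ φ ψ → (P (φ ∧ ψ) +R P (φ ∨ ψ)) ≈R (P φ +R P ψ)
    bot : P (⊥' θ₀) ≈R 0#
    top : P (⊤' θ₀) ≈R 1#
    multiplicative : ∀ φ ψ → ⊢ L (φ ⊠ ψ) → P (φ ∧ ψ) ≈R (P φ *R P ψ)

{-# OPTIONS --safe #-}
module Submission where

-- Unless □¬φ, b1 and b2 make (·|φ) monotone under □, while b3 and b4 give
-- φ → (ψ ↔ (ψ|φ)); together □(((ψ|φ)|φ) ↔ (ψ|φ)), i.e. (ψ|φ) × φ. If □¬φ, every formula
-- is independent of φ: in DmBL by b1 and b5, in DmBL* because b5.weak.B replaces φ by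
-- ⊥ = ¬⊤, b5.weak.A then replaces ⊥ by ⊤, and (ψ|⊤) ↔ ψ. Multiplicativity now gives
-- P(ψ|φ) P(φ) = P((ψ|φ) ∧ φ), and (ψ|φ) ∧ φ ≡ φ ∧ ψ by b3 and b4.
-- The purely propositional steps are tautology instances, derived by Kalmár's lemma.

open import Defs
open import Level using (Level)
open import Algebra.Bundles using (CommutativeRing)
open import Data.Bool using (Bool; true; false; not; T) renaming (_∨_ to _||_)
open import Data.Fin using (Fin; zero; suc)
open import Data.List using (List; []; _∷_)
open import Data.List.Membership.Propositional using (_∈_)
open import Data.List.Relation.Unary.Any using (here; there)
open import Data.Nat using (ℕ; zero; suc; _+_)
open import Data.Product using (_×_; _,_)
open import Data.Vec using (Vec; []; _∷_; lookup)
open import Function using (_∘_)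
open import Relation.Binary.PropositionalEquality using (refl)
import Relation.Binary.Reasoning.Setoid as SetoidReasoning

data Skeleton (n : ℕ) : Set where
  var : Fin n → Skeleton n
  ~_  : Skeleton n → Skeleton n
  _⊃_ : Skeleton n → Skeleton n → Skeleton n

infix  9 ~_
infixr 5 _⊃_

module _ {n : ℕ} where

  infixr 6 _&_
  infixr 5 _or_
  infix  4 _⟺_

  _or_ : Skeleton n → Skeleton n → Skeleton n
  p or q = ~ p ⊃ q

  _&_ : Skeleton n → Skeleton n → Skeleton n
  p & q = ~ (~ p or ~ q)

  _⟺_ : Skeleton n → Skeleton n → Skeleton n
  p ⟺ q = (p ⊃ q) & (q ⊃ p)

  eval : Skeleton n → Vec Bool n → Bool
  eval (var i) w = lookup w i
  eval (~ p)   w = not (eval p w)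
  eval (p ⊃ q) w = not (eval p w) || eval q w

AllValuations : ∀ n → (Vec Bool n → Set) → Set
AllValuations zero    P = P []
AllValuations (suc n) P = AllValuations n (P ∘ (true ∷_)) × AllValuations n (P ∘ (false ∷_))

allValuations : ∀ n {P : Vec Bool n → Set} → AllValuations n P → ∀ w → P w
allValuations zero    Pw        []          = Pw
allValuations (suc n) (Pt , Pf) (true  ∷ w) = allValuations n Pt w
allValuations (suc n) (Pt , Pf) (false ∷ w) = allValuations n Pf w

-- On closed skeletons this reduces to a product of unit types, so a proof of it is
-- found by Agda's eta rule and never has to be written.
Tautology : ∀ {n} → Skeleton n → Set
Tautology {n} p = AllValuations n (T ∘ eval p)

x₀ : ∀ {n} → Skeleton (1 + n)
x₀ = var zero
x₁ : ∀ {n} → Skeleton (2 + n)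
x₁ = var (suc zero)
x₂ : ∀ {n} → Skeleton (3 + n)
x₂ = var (suc (suc zero))
x₃ : ∀ {n} → Skeleton (4 + n)
x₃ = var (suc (suc (suc zero)))
x₄ : ∀ {n} → Skeleton (5 + n)
x₄ = var (suc (suc (suc (suc zero))))
x₅ : ∀ {n} → Skeleton (6 + n)
x₅ = var (suc (suc (suc (suc (suc zero)))))

module Hilbert {A : Set} (L : Logic) where

  infixl 4 _·_
  _·_ : ∀ {φ ψ : Fm A} → ⊢ L (φ ⇒ ψ) → ⊢ L φ → ⊢ L ψ
  _·_ = mp

  infix 3 _⊩_
  data _⊩_ (Γ : List (Fm A)) : Fm A → Set where
    hyp : ∀ {φ} → φ ∈ Γ → Γ ⊩ φ
    thm : ∀ {φ} → ⊢ L φ → Γ ⊩ φ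
    mph : ∀ {φ ψ} → Γ ⊩ (φ ⇒ ψ) → Γ ⊩ φ → Γ ⊩ ψ

  hyp₀ : ∀ {φ Γ} → (φ ∷ Γ) ⊩ φ
  hyp₀ = hyp (here refl)

  hyp₁ : ∀ {φ ψ Γ} → (ψ ∷ φ ∷ Γ) ⊩ φ
  hyp₁ = hyp (there (here refl))

  hyp₂ : ∀ {φ ψ η Γ} → (η ∷ ψ ∷ φ ∷ Γ) ⊩ φ
  hyp₂ = hyp (there (there (here refl)))

  ⇒-const : ∀ {Γ φ ψ} → Γ ⊩ φ → Γ ⊩ (ψ ⇒ φ)
  ⇒-const = mph (thm (c1 _ _))

  ⇒-refl : ∀ φ → ⊢ L (φ ⇒ φ)
  ⇒-refl φ = c2 φ (φ ⇒ φ) φ · c1 φ (φ ⇒ φ) · c1 φ φ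

  deduction : ∀ {Γ φ ψ} → (φ ∷ Γ) ⊩ ψ → Γ ⊩ (φ ⇒ ψ)
  deduction (hyp (here refl))  = thm (⇒-refl _)
  deduction (hyp (there φ∈Γ)) = ⇒-const (hyp φ∈Γ)
  deduction (thm t)            = ⇒-const (thm t)
  deduction (mph d e)          = mph (mph (thm (c2 _ _ _)) (deduction d)) (deduction e)

  closed : ∀ {φ} → [] ⊩ φ → ⊢ L φ
  closed (thm t)   = t
  closed (mph d e) = closed d · closed e

  ¬¬-elim : ∀ φ → ⊢ L (¬' ¬' φ ⇒ φ)
  ¬¬-elim φ = closed (deduction (mph (mph (thm (c3 φ (¬' φ))) (⇒-const hyp₀)) (thm (⇒-refl (¬' φ)))))

  ¬¬-intro : ∀ φ → ⊢ L (φ ⇒ ¬' ¬' φ)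
  ¬¬-intro φ = closed (deduction (mph (mph (thm (c3 (¬' ¬' φ) φ)) (thm (¬¬-elim (¬' φ)))) (⇒-const hyp₀)))

  explosion : ∀ φ ψ → ⊢ L (¬' φ ⇒ (φ ⇒ ψ))
  explosion φ ψ = closed (deduction (deduction (mph (mph (thm (c3 ψ φ)) (⇒-const hyp₁)) (⇒-const hyp₀))))

  ¬-⇒-intro : ∀ φ ψ → ⊢ L (φ ⇒ (¬' ψ ⇒ ¬' (φ ⇒ ψ)))
  ¬-⇒-intro φ ψ = closed (deduction (deduction
    (mph (mph (thm (c3 (¬' (φ ⇒ ψ)) ψ)) (⇒-const hyp₀))
         (deduction (mph (mph (thm (¬¬-elim (φ ⇒ ψ))) hyp₀) hyp₂)))))

  by-cases : ∀ φ ψ → ⊢ L ((¬' φ ⇒ ψ) ⇒ ((φ ⇒ ψ) ⇒ ψ))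
  by-cases φ ψ = closed (deduction (deduction (mph (mph (thm (c3 ψ φ)) ¬ψ⇒¬φ) ¬ψ⇒φ)))
    where
      ¬ψ⇒¬φ : ((φ ⇒ ψ) ∷ (¬' φ ⇒ ψ) ∷ []) ⊩ (¬' ψ ⇒ ¬' φ)
      ¬ψ⇒¬φ = deduction (mph (mph (thm (c3 (¬' φ) ψ)) (⇒-const hyp₀))
                           (deduction (mph hyp₂ (mph (thm (¬¬-elim φ)) hyp₀))))
      ¬ψ⇒φ : ((φ ⇒ ψ) ∷ (¬' φ ⇒ ψ) ∷ []) ⊩ (¬' ψ ⇒ φ)
      ¬ψ⇒φ = deduction (mph (mph (thm (c3 φ ψ)) (⇒-const hyp₀)) hyp₂)

  ⟦_⟧ : ∀ {n} → Skeleton n → Vec (Fm A) n → Fm A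
  ⟦ var i ⟧ ρ = lookup ρ i
  ⟦ ~ p ⟧   ρ = ¬' ⟦ p ⟧ ρ
  ⟦ p ⊃ q ⟧ ρ = ⟦ p ⟧ ρ ⇒ ⟦ q ⟧ ρ

  literal : Fm A → Bool → Fm A
  literal φ true  = φ
  literal φ false = ¬' φ

  literals : ∀ {n} → Vec (Fm A) n → Vec Bool n → List (Fm A)
  literals []      []      = []
  literals (φ ∷ ρ) (b ∷ w) = literal φ b ∷ literals ρ w

  literal∈literals : ∀ {n} (ρ : Vec (Fm A) n) w i → literal (lookup ρ i) (lookup w i) ∈ literals ρ w
  literal∈literals (φ ∷ ρ) (b ∷ w) zero    = here refl
  literal∈literals (φ ∷ ρ) (b ∷ w) (suc i) = there (literal∈literals ρ w i)

  kalmár : ∀ {n} (p : Skeleton n) ρ w → literals ρ w ⊩ literal (⟦ p ⟧ ρ) (eval p w)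
  kalmár (var i) ρ w = hyp (literal∈literals ρ w i)
  kalmár (~ p) ρ w with eval p w | kalmár p ρ w
  ... | true  | ⊩p  = mph (thm (¬¬-intro _)) ⊩p
  ... | false | ⊩¬p = ⊩¬p
  kalmár (p ⊃ q) ρ w with eval p w | kalmár p ρ w | eval q w | kalmár q ρ w
  ... | false | ⊩¬p | _     | _   = mph (thm (explosion _ _)) ⊩¬p
  ... | true  | _   | true  | ⊩q  = ⇒-const ⊩q
  ... | true  | ⊩p  | false | ⊩¬q = mph (mph (thm (¬-⇒-intro _ _)) ⊩p) ⊩¬q

  eliminate-literals : ∀ {n φ} (ρ : Vec (Fm A) n) → (∀ w → literals ρ w ⊩ φ) → [] ⊩ φ
  eliminate-literals []      ⊩φ = ⊩φ []
  eliminate-literals (ψ ∷ ρ) ⊩φ = eliminate-literals ρ λ w →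
    mph (mph (thm (by-cases ψ _)) (deduction (⊩φ (false ∷ w)))) (deduction (⊩φ (true ∷ w)))

  true-literal : ∀ {Γ φ} b → T b → Γ ⊩ literal φ b → Γ ⊩ φ
  true-literal true _ ⊩φ = ⊩φ

  tautology : ∀ {n} (p : Skeleton n) {_ : Tautology p} (ρ : Vec (Fm A) n) → ⊢ L (⟦ p ⟧ ρ)
  tautology {n} p {taut} ρ = closed (eliminate-literals ρ λ w →
    true-literal (eval p w) (allValuations n taut w) (kalmár p ρ w))

  □-mono : ∀ {φ ψ} → ⊢ L (φ ⇒ ψ) → ⊢ L (□ φ ⇒ □ ψ)
  □-mono {φ} {ψ} φ⇒ψ = m2 φ ψ · nec φ⇒ψ

  □-mono₂ : ∀ {φ ψ η} → ⊢ L (φ ⇒ (ψ ⇒ η)) → ⊢ L (□ φ ⇒ (□ ψ ⇒ □ η))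
  □-mono₂ {φ} {ψ} {η} φ⇒ψ⇒η =
    tautology ((x₀ ⊃ x₁) ⊃ (x₁ ⊃ x₂ ⊃ x₃) ⊃ x₀ ⊃ x₂ ⊃ x₃) (□ φ ∷ □ (ψ ⇒ η) ∷ □ ψ ∷ □ η ∷ [])
      · □-mono φ⇒ψ⇒η · m2 ψ η

module _ {A : Set} {L : Logic} where
  open Hilbert {A} L

  cond-intro : ∀ φ ψ → ⊢ L (φ ⇒ (ψ ⇒ cond ψ φ))
  cond-intro φ ψ =
    tautology ((~ x₁ ⟺ x₀) ⊃ (x₁ ⊃ x₂ ⊃ ~ x₃) ⊃ x₂ ⊃ x₃ ⊃ x₀) (cond ψ φ ∷ cond (¬' ψ) φ ∷ φ ∷ ψ ∷ [])
      · b4 φ ψ · b3 φ (¬' ψ)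

  cond∧antecedent⇔∧ : ∀ φ ψ → ⊢ L ((cond ψ φ ∧ φ) ⇔ (φ ∧ ψ))
  cond∧antecedent⇔∧ φ ψ =
    tautology ((x₀ ⊃ x₁ ⊃ x₂) ⊃ (x₁ ⊃ x₂ ⊃ x₀) ⊃ (x₀ & x₁ ⟺ x₁ & x₂)) (cond ψ φ ∷ φ ∷ ψ ∷ [])
      · b3 φ ψ · cond-intro φ ψ

  ⊠-theorem : ∀ {φ} ψ → ⊢ L φ → ⊢ L (ψ ⊠ φ)
  ⊠-theorem {φ} ψ ⊢φ = nec
    (tautology ((x₀ ⊃ x₁ ⊃ x₂) ⊃ (x₁ ⊃ x₂ ⊃ x₀) ⊃ x₁ ⊃ (x₀ ⟺ x₂)) (cond ψ φ ∷ φ ∷ ψ ∷ [])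
      · b3 φ ψ · cond-intro φ ψ · ⊢φ)

  ¬⊠⇒⊠ : ∀ φ ψ → ⊢ L ((¬' ψ ⊠ φ) ⇒ (ψ ⊠ φ))
  ¬⊠⇒⊠ φ ψ = □-mono
    (tautology ((~ x₀ ⟺ x₁) ⊃ (x₀ ⟺ ~ x₂) ⊃ (x₁ ⟺ x₂)) (cond (¬' ψ) φ ∷ cond ψ φ ∷ ψ ∷ [])
      · b4 φ ψ)

  cond-mono-unless-□¬ : ∀ {φ ψ η} → ⊢ L (φ ⇒ (ψ ⇒ η)) → ⊢ L (□ ¬' φ ∨ □ (cond ψ φ ⇒ cond η φ))
  cond-mono-unless-□¬ {φ} {ψ} {η} φ⇒ψ⇒η =
    tautology ((x₀ or x₁) ⊃ (x₁ ⊃ x₂) ⊃ (x₀ or x₂))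
      (□ ¬' φ ∷ □ cond (ψ ⇒ η) φ ∷ □ (cond ψ φ ⇒ cond η φ) ∷ [])
      · (b1 φ (ψ ⇒ η) · nec φ⇒ψ⇒η) · □-mono (b2 φ ψ η)

module _ {A : Set} where
  open Hilbert {A} DmBL

  □¬⇒□¬∨⊠-DmBL : ∀ φ ψ → ⊢ DmBL (□ ¬' φ ⇒ (□ ¬' ψ ∨ (ψ ⊠ φ)))
  □¬⇒□¬∨⊠-DmBL φ ψ =
    tautology ((x₀ ⊃ x₁) ⊃ (x₁ ⊃ x₂ or x₃) ⊃ (x₃ ⊃ x₀ ⊃ x₄) ⊃ (x₄ ⟺ x₅) ⊃ x₀ ⊃ x₂ or x₅)
      (□ ¬' φ ∷ □ (ψ ⇒ ¬' φ) ∷ □ ¬' ψ ∷ □ cond (¬' φ) ψ ∷ (φ ⊠ ψ) ∷ (ψ ⊠ φ) ∷ [])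
      · □-mono (c1 (¬' φ) ψ) · b1 ψ (¬' φ) · □-mono₂ ¬φ|ψ⇒¬φ⇒φ|ψ⇔φ · b5 ψ φ
    where
      ¬φ|ψ⇒¬φ⇒φ|ψ⇔φ : ⊢ DmBL (cond (¬' φ) ψ ⇒ (¬' φ ⇒ (cond φ ψ ⇔ φ)))
      ¬φ|ψ⇒¬φ⇒φ|ψ⇔φ =
        tautology ((~ x₀ ⟺ x₁) ⊃ x₀ ⊃ ~ x₂ ⊃ (x₁ ⟺ x₂)) (cond (¬' φ) ψ ∷ cond φ ψ ∷ φ ∷ [])
          · b4 ψ φ

  □¬⇒⊠-DmBL : ∀ φ ψ → ⊢ DmBL (□ ¬' φ ⇒ (ψ ⊠ φ))
  □¬⇒⊠-DmBL φ ψ =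
    tautology ((x₀ ⊃ x₁ or x₂) ⊃ (x₀ ⊃ x₃ or x₄) ⊃ (x₁ ⊃ ~ x₅) ⊃ (x₃ ⊃ ~ ~ x₅) ⊃ (x₄ ⊃ x₂) ⊃ x₀ ⊃ x₂)
      (□ ¬' φ ∷ □ ¬' ψ ∷ (ψ ⊠ φ) ∷ □ ¬' ¬' ψ ∷ (¬' ψ ⊠ φ) ∷ ψ ∷ [])
      · □¬⇒□¬∨⊠-DmBL φ ψ · □¬⇒□¬∨⊠-DmBL φ (¬' ψ) · m3 (¬' ψ) · m3 (¬' ¬' ψ) · ¬⊠⇒⊠ φ ψ

module _ {A : Set} (θ₀ : A) where
  open Hilbert {A} DmBL*

  ⊠-⊥ : ∀ ψ → ⊢ DmBL* (ψ ⊠ ⊥' θ₀)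
  ⊠-⊥ ψ = tautology ((x₀ ⟺ x₁) ⊃ x₁ ⊃ x₀) ((ψ ⊠ ⊥' θ₀) ∷ (ψ ⊠ ⊤' θ₀) ∷ [])
    · b5-weak-A (⊤' θ₀) ψ · ⊠-theorem ψ (⇒-refl (atom θ₀))

  □¬⇒⊠-DmBL* : ∀ φ ψ → ⊢ DmBL* (□ ¬' φ ⇒ (ψ ⊠ φ))
  □¬⇒⊠-DmBL* φ ψ =
    tautology ((x₀ ⊃ x₁) ⊃ (x₁ ⊃ x₂) ⊃ (x₂ ⊃ x₃ ⊃ x₄) ⊃ x₃ ⊃ x₀ ⊃ x₄)
      (□ ¬' φ ∷ □ (φ ⇔ ⊥' θ₀) ∷ □ (cond ψ φ ⇔ cond ψ (⊥' θ₀)) ∷ (ψ ⊠ ⊥' θ₀) ∷ (ψ ⊠ φ) ∷ [])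
      · □-mono (tautology (~ x₀ ⊃ (x₀ ⟺ ~ (x₁ ⊃ x₁))) (φ ∷ atom θ₀ ∷ []))
      · b5-weak-B ψ φ (⊥' θ₀)
      · □-mono₂ (tautology ((x₀ ⟺ x₁) ⊃ (x₁ ⟺ x₂) ⊃ (x₀ ⟺ x₂)) (cond ψ φ ∷ cond ψ (⊥' θ₀) ∷ ψ ∷ []))
      · ⊠-⊥ ψ

□¬⇒⊠ : ∀ {A : Set} (θ₀ : A) L (φ ψ : Fm A) → ⊢ L (□ ¬' φ ⇒ (ψ ⊠ φ))
□¬⇒⊠ θ₀ DmBL  = □¬⇒⊠-DmBL
□¬⇒⊠ θ₀ DmBL* = □¬⇒⊠-DmBL* θ₀

cond-⊠-antecedent : ∀ {A : Set} (θ₀ : A) L (φ ψ : Fm A) → ⊢ L (cond ψ φ ⊠ φ)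
cond-⊠-antecedent θ₀ L φ ψ =
  tautology ((x₀ or x₁) ⊃ (x₀ or x₂) ⊃ (x₁ ⊃ x₂ ⊃ x₃) ⊃ (x₀ ⊃ x₃) ⊃ x₃)
    (□ ¬' φ ∷ □ (cond X φ ⇒ X) ∷ □ (X ⇒ cond X φ) ∷ (X ⊠ φ) ∷ [])
    · cond-mono-unless-□¬ (tautology ((x₀ ⊃ x₁ ⊃ x₂) ⊃ x₁ ⊃ x₀ ⊃ x₂) (X ∷ φ ∷ ψ ∷ []) · b3 φ ψ)
    · cond-mono-unless-□¬ (cond-intro φ ψ)
    · □-mono₂ (tautology ((x₀ ⊃ x₁) ⊃ (x₁ ⊃ x₀) ⊃ (x₀ ⟺ x₁)) (cond X φ ∷ X ∷ []))
    · □¬⇒⊠ θ₀ L φ X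
  where
    open Hilbert L
    X = cond ψ φ

mainTheorem19 : ∀ {c ℓ ℓ' : Level} {A : Set} (θ₀ : A) (L : Logic)
    (R : CommutativeRing c ℓ)
    (_≤_ : CommutativeRing.Carrier R → CommutativeRing.Carrier R → Set ℓ')
    (P : Fm A → CommutativeRing.Carrier R) →
    IsProbability θ₀ L R _≤_ P →
    ∀ φ ψ → CommutativeRing._≈_ R (CommutativeRing._*_ R (P (cond ψ φ)) (P φ)) (P (φ ∧ ψ))
mainTheorem19 θ₀ L R _≤_ P isP φ ψ = begin
  P (cond ψ φ) * P φ  ≈⟨ multiplicative (cond ψ φ) φ (cond-⊠-antecedent θ₀ L φ ψ) ⟨
  P (cond ψ φ ∧ φ)    ≈⟨ respect _ _ (cond∧antecedent⇔∧ φ ψ) ⟩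
  P (φ ∧ ψ)           ∎
  where
    open CommutativeRing R using (_*_; setoid)
    open IsProbability isP
    open SetoidReasoning setoid
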